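{- For every formula $\alpha$ of the language $\{\vee,\wedge,\neg,\square\}$: if $\not\models_{\cal TML}\alpha$, then every completed tableau of $\mathbb T'$ for $F(\alpha)$ is open.
   Context: $\mathfrak M_{4m}$ is the lattice $M_4=\{\mathbf 0,\mathbf n,\mathbf b,\mathbf 1\}$ ($\mathbf 0<\mathbf n,\mathbf b<\mathbf 1$, $\mathbf n,\mathbf b$ incomparable) with $\neg\mathbf 0=\mathbf 1$, $\neg\mathbf 1=\mathbf 0$, $\neg\mathbf n=\mathbf n$, $\neg\mathbf b=\mathbf b$, $\square\mathbf 1=\mathbf 1$, $\square x=\mathbf 0$ for $x\ne\mathbf 1$; it generates the variety of tetravalent modal algebras. Formulas are built from propositional variables with $\vee,\wedge,\neg,\square$; a valuation is a homomorphism $h$ into $\mathfrak M_{4m}$; $\models_{\cal TML}\alpha$ means $h(\alpha)=\mathbf 1$ for every valuation $h$. Signed formulas: $T(\alpha)$, $F(\alpha)$. Rules of $\mathbb T'$ (premise $\Rightarrow$ conclusion sets separated by $|$): $T(\alpha\vee\beta)\Rightarrow\{T(\alpha)\}|\{T(\beta)\}$; $T(\neg(\alpha\vee\beta))\Rightarrow\{T(\neg\alpha),T(\neg\beta)\}$; $F(\alpha\vee\beta)\Rightarrow\{F(\alpha),F(\beta)\}$; $F(\neg(\alpha\vee\beta))\Rightarrow\{F(\neg\alpha)\}|\{F(\neg\beta)\}$; $T(\alpha\wedge\beta)\Rightarrow\{T(\alpha),T(\beta)\}$; $T(\neg(\alpha\wedge\beta))\Rightarrow\{T(\neg\alpha)\}|\{T(\neg\beta)\}$;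 $F(\alpha\wedge\beta)\Rightarrow\{F(\alpha)\}|\{F(\beta)\}$; $F(\neg(\alpha\wedge\beta))\Rightarrow\{F(\neg\alpha),F(\neg\beta)\}$; $T(\neg\neg\alpha)\Rightarrow\{T(\alpha)\}$; $F(\neg\neg\alpha)\Rightarrow\{F(\alpha)\}$; $T(\square\alpha)\Rightarrow\{T(\alpha),F(\neg\alpha)\}$; $F(\square\alpha)\Rightarrow\{F(\alpha)\}|\{T(\neg\alpha)\}$; $T(\neg\square\alpha)\Rightarrow\{F(\square\alpha)\}$; $F(\neg\square\alpha)\Rightarrow\{T(\square\alpha)\}$. A tableau for $\eta$ is a finite tree with root $\eta$ built by repeatedly choosing a non-closed branch and a signed formula on it that is a rule premise, and extending the branch by one sub-branch per conclusion set. A branch is closed if it contains $T(\gamma)$ and $F(\gamma)$ for some $\gamma$, open otherwise; a tableau is open if some branch is open; it is completed if on every non-closed branch every rule whose premise occurs on the branch has been applied to it along that branch. -}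

module Defs where

open import Data.Nat using (ℕ)
open import Data.List using (List; []; _∷_; _++_; map)
open import Data.List.Membership.Propositional using (_∈_)
open import Data.Maybe using (Maybe; just; nothing)
open import Data.Product using (Σ; ∃; _×_; _,_)
open import Relation.Nullary using (¬_)
open import Relation.Binary.PropositionalEquality using (_≡_)

infixr 5 _∨_
infixr 6 _∧_

data Fm : Set where
  var : ℕ → Fm
  _∨_ : Fm → Fm → Fm
  _∧_ : Fm → Fm → Fm
  ¬′  : Fm → Fm
  □   : Fm → Fm

data M4 : Set where
  𝟎 𝐧 𝐛 𝟏 : M4

_⊔_ : M4 → M4 → M4
𝟎 ⊔ y = y
𝟏 ⊔ y = 𝟏
𝐧 ⊔ 𝟎 = 𝐧
𝐧 ⊔ 𝐧 = 𝐧
𝐧 ⊔ 𝐛 = 𝟏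
𝐧 ⊔ 𝟏 = 𝟏
𝐛 ⊔ 𝟎 = 𝐛
𝐛 ⊔ 𝐧 = 𝟏
𝐛 ⊔ 𝐛 = 𝐛
𝐛 ⊔ 𝟏 = 𝟏

_⊓_ : M4 → M4 → M4
𝟎 ⊓ y = 𝟎
𝟏 ⊓ y = y
𝐧 ⊓ 𝟎 = 𝟎
𝐧 ⊓ 𝐧 = 𝐧
𝐧 ⊓ 𝐛 = 𝟎
𝐧 ⊓ 𝟏 = 𝐧
𝐛 ⊓ 𝟎 = 𝟎
𝐛 ⊓ 𝐧 = 𝟎
𝐛 ⊓ 𝐛 = 𝐛
𝐛 ⊓ 𝟏 = 𝐛

∼_ : M4 → M4
∼ 𝟎 = 𝟏
∼ 𝐧 = 𝐧
∼ 𝐛 = 𝐛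
∼ 𝟏 = 𝟎

■_ : M4 → M4
■ 𝟏 = 𝟏
■ 𝟎 = 𝟎
■ 𝐧 = 𝟎
■ 𝐛 = 𝟎

-- A valuation (homomorphism from the free formula algebra) is determined
-- by its values on the propositional variables.
⟦_⟧ : Fm → (ℕ → M4) → M4
⟦ var n ⟧ v = v n
⟦ a ∨ b ⟧ v = ⟦ a ⟧ v ⊔ ⟦ b ⟧ v
⟦ a ∧ b ⟧ v = ⟦ a ⟧ v ⊓ ⟦ b ⟧ v
⟦ ¬′ a ⟧ v = ∼ ⟦ a ⟧ v
⟦ □ a ⟧ v = ■ ⟦ a ⟧ v

⊨TML : Fm → Set
⊨TML α = (v : ℕ → M4) → ⟦ α ⟧ v ≡ 𝟏

data Signed : Set where
  T F : Fm → Signed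

-- rule φ = just [c₁ , … , cₖ] when φ is a premise of a rule with
-- conclusion sets c₁ | … | cₖ ; nothing when φ is not a premise.
rule : Signed → Maybe (List (List Signed))
rule (T (a ∨ b)) = just ((T a ∷ []) ∷ (T b ∷ []) ∷ [])
rule (T (¬′ (a ∨ b))) = just ((T (¬′ a) ∷ T (¬′ b) ∷ []) ∷ [])
rule (F (a ∨ b)) = just ((F a ∷ F b ∷ []) ∷ [])
rule (F (¬′ (a ∨ b))) = just ((F (¬′ a) ∷ []) ∷ (F (¬′ b) ∷ []) ∷ [])
rule (T (a ∧ b)) = just ((T a ∷ T b ∷ []) ∷ [])
rule (T (¬′ (a ∧ b))) = just ((T (¬′ a) ∷ []) ∷ (T (¬′ b) ∷ []) ∷ [])
rule (F (a ∧ b)) = just ((F a ∷ []) ∷ (F b ∷ []) ∷ [])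
rule (F (¬′ (a ∧ b))) = just ((F (¬′ a) ∷ F (¬′ b) ∷ []) ∷ [])
rule (T (¬′ (¬′ a))) = just ((T a ∷ []) ∷ [])
rule (F (¬′ (¬′ a))) = just ((F a ∷ []) ∷ [])
rule (T (□ a)) = just ((T a ∷ F (¬′ a) ∷ []) ∷ [])
rule (F (□ a)) = just ((F a ∷ []) ∷ (T (¬′ a) ∷ []) ∷ [])
rule (T (¬′ (□ a))) = just ((F (□ a) ∷ []) ∷ [])
rule (F (¬′ (□ a))) = just ((T (□ a) ∷ []) ∷ [])
rule (T (var n)) = nothing
rule (F (var n)) = nothing
rule (T (¬′ (var n))) = nothing
rule (F (¬′ (var n))) = nothing

IsPremise : Signed → Set
IsPremise φ = ∃ λ cs → rule φ ≡ just cs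

-- A finite tree is represented by the list of its branches
-- (root-to-leaf paths); each branch records the signed formulas on it
-- and the premises to which a rule has been applied along it.

record Branch : Set where
  constructor ⟨_,_⟩
  field
    formulas : List Signed
    applied  : List Signed
open Branch public

Closed : Branch → Set
Closed b = ∃ λ γ → (T γ ∈ formulas b) × (F γ ∈ formulas b)

extend : Branch → Signed → List Signed → Branch
extend b φ c = ⟨ formulas b ++ c , φ ∷ applied b ⟩

data IsTableau (η : Signed) : List Branch → Set where
  root : IsTableau η (⟨ η ∷ [] , [] ⟩ ∷ [])
  step : ∀ bs₁ b bs₂ φ cs →
         IsTableau η (bs₁ ++ b ∷ bs₂) →
         ¬ Closed b →
         φ ∈ formulas b →
         rule φ ≡ just cs →
         IsTableau η (bs₁ ++ map (extend b φ) cs ++ bs₂)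

OpenTableau : List Branch → Set
OpenTableau bs = ∃ λ b → (b ∈ bs) × ¬ Closed b

Completed : List Branch → Set
Completed bs = ∀ b → b ∈ bs → ¬ Closed b →
               ∀ φ → φ ∈ formulas b → IsPremise φ → φ ∈ applied b

-- The two prime filters ↑𝐧 = {𝐧, 𝟏} and ↑𝐛 = {𝐛, 𝟏} of 𝔐₄ₘ give, for each
-- valuation v, a reading of T(γ) as "the value of γ under v lies in the
-- filter" and of F(γ) as "it does not".  Every rule of 𝕋′ is sound for both
-- readings (the filters are prime, ∼ satisfies De Morgan and double negation,
-- and ■x ∈ P exactly when x ∈ P and ∼x ∉ P), so a branch all of whose formulas
-- hold under some reading survives every expansion, and such a branch cannot
-- be closed.  If every tableau branch for F(α) were closed, no reading could
-- make F(α) true, so the value of α would lie in both filters, i.e. be 𝟏, for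
-- every v.  Since openness of a finite tableau is decidable, the refutation of
-- validity then yields an open branch.
module Submission where

open import Defs
open import Data.Bool using (Bool; true; false; not) renaming (_∧_ to _∧ᵇ_; _∨_ to _∨ᵇ_)
open import Data.Bool.Properties using (∧-conicalˡ; ∧-conicalʳ; ∨-conicalˡ; ∨-conicalʳ; not-injective; ¬-not)
open import Data.Empty using (⊥)
open import Data.List using (List; []; _∷_; map)
open import Data.List.Membership.Propositional using (_∈_; find; lose)
import Data.List.Membership.DecPropositional as DecMembership
open import Data.List.Relation.Unary.All as All using (All; []; _∷_)
import Data.List.Relation.Unary.All.Properties as Allₚ
open import Data.List.Relation.Unary.Any as Any using (Any; here; there; any?)
import Data.List.Relation.Unary.Any.Properties as Anyₚ
open import Data.Maybe using (just)
open import Data.Nat using (ℕ) renaming (_≟_ to _≟ℕ_)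
open import Data.Product using (_×_; _,_; uncurry)
open import Data.Sum using (_⊎_; inj₁; inj₂)
open import Function using (_∘_)
open import Relation.Binary.Definitions using (DecidableEquality)
open import Relation.Binary.PropositionalEquality using (_≡_; refl; sym; trans; cong; cong₂)
open import Relation.Nullary using (¬_; Dec; no; ¬?)
open import Relation.Nullary.Decidable using (map′; _×-dec_; decidable-stable)

data PrimeFilter : Set where
  ↑𝐧 ↑𝐛 : PrimeFilter

infix 10 _∈ᵇ_
_∈ᵇ_ : M4 → PrimeFilter → Bool
𝟎 ∈ᵇ _  = false
𝟏 ∈ᵇ _  = true
𝐧 ∈ᵇ ↑𝐧 = true
𝐧 ∈ᵇ ↑𝐛 = false
𝐛 ∈ᵇ ↑𝐧 = false
𝐛 ∈ᵇ ↑𝐛 = true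

∈ᵇ-⊔ : ∀ P x y → (x ⊔ y) ∈ᵇ P ≡ x ∈ᵇ P ∨ᵇ y ∈ᵇ P
∈ᵇ-⊔ P  𝟎 y = refl
∈ᵇ-⊔ P  𝟏 y = refl
∈ᵇ-⊔ ↑𝐧 𝐧 𝟎 = refl
∈ᵇ-⊔ ↑𝐧 𝐧 𝐧 = refl
∈ᵇ-⊔ ↑𝐧 𝐧 𝐛 = refl
∈ᵇ-⊔ ↑𝐧 𝐧 𝟏 = refl
∈ᵇ-⊔ ↑𝐛 𝐧 𝟎 = refl
∈ᵇ-⊔ ↑𝐛 𝐧 𝐧 = refl
∈ᵇ-⊔ ↑𝐛 𝐧 𝐛 = refl
∈ᵇ-⊔ ↑𝐛 𝐧 𝟏 = refl
∈ᵇ-⊔ ↑𝐧 𝐛 𝟎 = refl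
∈ᵇ-⊔ ↑𝐧 𝐛 𝐧 = refl
∈ᵇ-⊔ ↑𝐧 𝐛 𝐛 = refl
∈ᵇ-⊔ ↑𝐧 𝐛 𝟏 = refl
∈ᵇ-⊔ ↑𝐛 𝐛 𝟎 = refl
∈ᵇ-⊔ ↑𝐛 𝐛 𝐧 = refl
∈ᵇ-⊔ ↑𝐛 𝐛 𝐛 = refl
∈ᵇ-⊔ ↑𝐛 𝐛 𝟏 = refl

∈ᵇ-⊓ : ∀ P x y → (x ⊓ y) ∈ᵇ P ≡ x ∈ᵇ P ∧ᵇ y ∈ᵇ P
∈ᵇ-⊓ P  𝟎 y = refl
∈ᵇ-⊓ P  𝟏 y = refl
∈ᵇ-⊓ ↑𝐧 𝐧 𝟎 = refl
∈ᵇ-⊓ ↑𝐧 𝐧 𝐧 = refl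
∈ᵇ-⊓ ↑𝐧 𝐧 𝐛 = refl
∈ᵇ-⊓ ↑𝐧 𝐧 𝟏 = refl
∈ᵇ-⊓ ↑𝐛 𝐧 𝟎 = refl
∈ᵇ-⊓ ↑𝐛 𝐧 𝐧 = refl
∈ᵇ-⊓ ↑𝐛 𝐧 𝐛 = refl
∈ᵇ-⊓ ↑𝐛 𝐧 𝟏 = refl
∈ᵇ-⊓ ↑𝐧 𝐛 𝟎 = refl
∈ᵇ-⊓ ↑𝐧 𝐛 𝐧 = refl
∈ᵇ-⊓ ↑𝐧 𝐛 𝐛 = refl
∈ᵇ-⊓ ↑𝐧 𝐛 𝟏 = refl
∈ᵇ-⊓ ↑𝐛 𝐛 𝟎 = refl
∈ᵇ-⊓ ↑𝐛 𝐛 𝐧 = refl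
∈ᵇ-⊓ ↑𝐛 𝐛 𝐛 = refl
∈ᵇ-⊓ ↑𝐛 𝐛 𝟏 = refl

∈ᵇ-■ : ∀ P x → (■ x) ∈ᵇ P ≡ x ∈ᵇ P ∧ᵇ not (∼ x ∈ᵇ P)
∈ᵇ-■ P  𝟎 = refl
∈ᵇ-■ P  𝟏 = refl
∈ᵇ-■ ↑𝐧 𝐧 = refl
∈ᵇ-■ ↑𝐛 𝐧 = refl
∈ᵇ-■ ↑𝐧 𝐛 = refl
∈ᵇ-■ ↑𝐛 𝐛 = refl

∈ᵇ-∼■ : ∀ P x → ∼ (■ x) ∈ᵇ P ≡ not (■ x ∈ᵇ P)
∈ᵇ-∼■ P 𝟎 = refl
∈ᵇ-∼■ P 𝐧 = refl
∈ᵇ-∼■ P 𝐛 = refl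
∈ᵇ-∼■ P 𝟏 = refl

∈ᵇ-both⇒≡𝟏 : ∀ x → x ∈ᵇ ↑𝐧 ≡ true → x ∈ᵇ ↑𝐛 ≡ true → x ≡ 𝟏
∈ᵇ-both⇒≡𝟏 𝟏 _ _ = refl
∈ᵇ-both⇒≡𝟏 𝟎 () _
∈ᵇ-both⇒≡𝟏 𝐧 _ ()
∈ᵇ-both⇒≡𝟏 𝐛 () _

∼-involutive : ∀ x → ∼ (∼ x) ≡ x
∼-involutive 𝟎 = refl
∼-involutive 𝐧 = refl
∼-involutive 𝐛 = refl
∼-involutive 𝟏 = refl

∼-⊔ : ∀ x y → ∼ (x ⊔ y) ≡ (∼ x) ⊓ (∼ y)
∼-⊔ 𝟎 y = refl
∼-⊔ 𝟏 y = refl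
∼-⊔ 𝐧 𝟎 = refl
∼-⊔ 𝐧 𝐧 = refl
∼-⊔ 𝐧 𝐛 = refl
∼-⊔ 𝐧 𝟏 = refl
∼-⊔ 𝐛 𝟎 = refl
∼-⊔ 𝐛 𝐧 = refl
∼-⊔ 𝐛 𝐛 = refl
∼-⊔ 𝐛 𝟏 = refl

∼-⊓ : ∀ x y → ∼ (x ⊓ y) ≡ (∼ x) ⊔ (∼ y)
∼-⊓ 𝟎 y = refl
∼-⊓ 𝟏 y = refl
∼-⊓ 𝐧 𝟎 = refl
∼-⊓ 𝐧 𝐧 = refl
∼-⊓ 𝐧 𝐛 = refl
∼-⊓ 𝐧 𝟏 = refl
∼-⊓ 𝐛 𝟎 = refl
∼-⊓ 𝐛 𝐧 = refl
∼-⊓ 𝐛 𝐛 = refl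
∼-⊓ 𝐛 𝟏 = refl

∈ᵇ-∼⊔ : ∀ P x y → ∼ (x ⊔ y) ∈ᵇ P ≡ ∼ x ∈ᵇ P ∧ᵇ ∼ y ∈ᵇ P
∈ᵇ-∼⊔ P x y = trans (cong (_∈ᵇ P) (∼-⊔ x y)) (∈ᵇ-⊓ P (∼ x) (∼ y))

∈ᵇ-∼⊓ : ∀ P x y → ∼ (x ⊓ y) ∈ᵇ P ≡ ∼ x ∈ᵇ P ∨ᵇ ∼ y ∈ᵇ P
∈ᵇ-∼⊓ P x y = trans (cong (_∈ᵇ P) (∼-⊓ x y)) (∈ᵇ-⊔ P (∼ x) (∼ y))

∈ᵇ-∼∼ : ∀ P x → ∼ (∼ x) ∈ᵇ P ≡ x ∈ᵇ P
∈ᵇ-∼∼ P x = cong (_∈ᵇ P) (∼-involutive x)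

∧ᵇ-≡-true : ∀ {x y} → x ∧ᵇ y ≡ true → x ≡ true × y ≡ true
∧ᵇ-≡-true {x} {y} e = ∧-conicalˡ x y e , ∧-conicalʳ x y e

∨ᵇ-≡-false : ∀ {x y} → x ∨ᵇ y ≡ false → x ≡ false × y ≡ false
∨ᵇ-≡-false {x} {y} e = ∨-conicalˡ x y e , ∨-conicalʳ x y e

∨ᵇ-≡-true : ∀ {x y} → x ∨ᵇ y ≡ true → x ≡ true ⊎ y ≡ true
∨ᵇ-≡-true {true}  _ = inj₁ refl
∨ᵇ-≡-true {false} e = inj₂ e

∧ᵇ-≡-false : ∀ {x y} → x ∧ᵇ y ≡ false → x ≡ false ⊎ y ≡ false
∧ᵇ-≡-false {false} _ = inj₁ refl
∧ᵇ-≡-false {true}  e = inj₂ e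

module Reading (P : PrimeFilter) (v : ℕ → M4) where

  ⟦_⟧ᵥ : Fm → M4
  ⟦ γ ⟧ᵥ = ⟦ γ ⟧ v

  Holds : Signed → Set
  Holds (T γ) = ⟦ γ ⟧ᵥ ∈ᵇ P ≡ true
  Holds (F γ) = ⟦ γ ⟧ᵥ ∈ᵇ P ≡ false

  HoldsOn : Branch → Set
  HoldsOn b = All Holds (formulas b)

  along : ∀ {x y z : Bool} → x ≡ y → x ≡ z → y ≡ z
  along x≡y x≡z = trans (sym x≡y) x≡z

  either : ∀ {φ ψ} → Holds φ ⊎ Holds ψ → Any (All Holds) ((φ ∷ []) ∷ (ψ ∷ []) ∷ [])
  either (inj₁ h) = here (h ∷ [])
  either (inj₂ h) = there (here (h ∷ []))

  both : ∀ {φ ψ} → Holds φ × Holds ψ → Any (All Holds) ((φ ∷ ψ ∷ []) ∷ [])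
  both (h , h′) = here (h ∷ h′ ∷ [])

  only : ∀ {φ} → Holds φ → Any (All Holds) ((φ ∷ []) ∷ [])
  only h = here (h ∷ [])

  rule-sound : ∀ φ {cs} → rule φ ≡ just cs → Holds φ → Any (All Holds) cs
  rule-sound (T (a ∨ b))       refl h = either (∨ᵇ-≡-true (along (∈ᵇ-⊔ P ⟦ a ⟧ᵥ ⟦ b ⟧ᵥ) h))
  rule-sound (T (¬′ (a ∨ b)))  refl h = both (∧ᵇ-≡-true (along (∈ᵇ-∼⊔ P ⟦ a ⟧ᵥ ⟦ b ⟧ᵥ) h))
  rule-sound (F (a ∨ b))       refl h = both (∨ᵇ-≡-false (along (∈ᵇ-⊔ P ⟦ a ⟧ᵥ ⟦ b ⟧ᵥ) h))
  rule-sound (F (¬′ (a ∨ b)))  refl h = either (∧ᵇ-≡-false (along (∈ᵇ-∼⊔ P ⟦ a ⟧ᵥ ⟦ b ⟧ᵥ) h))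
  rule-sound (T (a ∧ b))       refl h = both (∧ᵇ-≡-true (along (∈ᵇ-⊓ P ⟦ a ⟧ᵥ ⟦ b ⟧ᵥ) h))
  rule-sound (T (¬′ (a ∧ b)))  refl h = either (∨ᵇ-≡-true (along (∈ᵇ-∼⊓ P ⟦ a ⟧ᵥ ⟦ b ⟧ᵥ) h))
  rule-sound (F (a ∧ b))       refl h = either (∧ᵇ-≡-false (along (∈ᵇ-⊓ P ⟦ a ⟧ᵥ ⟦ b ⟧ᵥ) h))
  rule-sound (F (¬′ (a ∧ b)))  refl h = both (∨ᵇ-≡-false (along (∈ᵇ-∼⊓ P ⟦ a ⟧ᵥ ⟦ b ⟧ᵥ) h))
  rule-sound (T (¬′ (¬′ a)))   refl h = only (along (∈ᵇ-∼∼ P ⟦ a ⟧ᵥ) h)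
  rule-sound (F (¬′ (¬′ a)))   refl h = only (along (∈ᵇ-∼∼ P ⟦ a ⟧ᵥ) h)
  rule-sound (T (□ a))         refl h with ∧ᵇ-≡-true (along (∈ᵇ-■ P ⟦ a ⟧ᵥ) h)
  ... | a∈P , ¬a∉P = both (a∈P , not-injective ¬a∉P)
  rule-sound (F (□ a))         refl h with ∧ᵇ-≡-false (along (∈ᵇ-■ P ⟦ a ⟧ᵥ) h)
  ... | inj₁ a∉P = either (inj₁ a∉P)
  ... | inj₂ ¬a∈P = either (inj₂ (not-injective ¬a∈P))
  rule-sound (T (¬′ (□ a)))    refl h = only (not-injective (along (∈ᵇ-∼■ P ⟦ a ⟧ᵥ) h))
  rule-sound (F (¬′ (□ a)))    refl h = only (not-injective (along (∈ᵇ-∼■ P ⟦ a ⟧ᵥ) h))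
  rule-sound (T (var _))       ()
  rule-sound (F (var _))       ()
  rule-sound (T (¬′ (var _)))  ()
  rule-sound (F (¬′ (var _)))  ()

  holds-on-extension : ∀ {b φ cs} → HoldsOn b → φ ∈ formulas b → rule φ ≡ just cs →
                       Any HoldsOn (map (extend b φ) cs)
  holds-on-extension {φ = φ} hb φ∈b eq =
    Anyₚ.map⁺ (Any.map (Allₚ.++⁺ hb) (rule-sound φ eq (All.lookup hb φ∈b)))

  tableau-sound : ∀ {η bs} → IsTableau η bs → Holds η → Any HoldsOn bs
  tableau-sound root hη = here (hη ∷ [])
  tableau-sound (step bs₁ b bs₂ φ cs t _ φ∈b eq) hη
    with Anyₚ.++⁻ bs₁ (tableau-sound t hη)
  ... | inj₁ in-bs₁ = Anyₚ.++⁺ˡ in-bs₁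
  ... | inj₂ (here hb) = Anyₚ.++⁺ʳ bs₁ (Anyₚ.++⁺ˡ (holds-on-extension hb φ∈b eq))
  ... | inj₂ (there in-bs₂) = Anyₚ.++⁺ʳ bs₁ (Anyₚ.++⁺ʳ (map (extend b φ) cs) in-bs₂)

  holds-on⇒¬closed : ∀ {b} → HoldsOn b → ¬ Closed b
  holds-on⇒¬closed hb (γ , Tγ∈b , Fγ∈b)
    with trans (sym (All.lookup hb Tγ∈b)) (All.lookup hb Fγ∈b)
  ... | ()

  holds-on-some⇒open : ∀ {bs} → Any HoldsOn bs → OpenTableau bs
  holds-on-some⇒open = find ∘ Any.map (λ {b} → holds-on⇒¬closed {b})

closed-tableau⇒valid : ∀ {α bs} → IsTableau (F α) bs → ¬ OpenTableau bs → ⊨TML α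
closed-tableau⇒valid {α} t ¬open v =
  ∈ᵇ-both⇒≡𝟏 (⟦ α ⟧ v) (¬-not (refuted ↑𝐧)) (¬-not (refuted ↑𝐛))
  where
  refuted : ∀ P → ¬ ⟦ α ⟧ v ∈ᵇ P ≡ false
  refuted P α∉P = ¬open (holds-on-some⇒open (tableau-sound t α∉P))
    where open Reading P v

var-injective : ∀ {m n} → var m ≡ var n → m ≡ n
var-injective refl = refl

∨-injective : ∀ {a b c d} → a ∨ b ≡ c ∨ d → a ≡ c × b ≡ d
∨-injective refl = refl , refl

∧-injective : ∀ {a b c d} → a ∧ b ≡ c ∧ d → a ≡ c × b ≡ d
∧-injective refl = refl , refl

¬′-injective : ∀ {a b} → ¬′ a ≡ ¬′ b → a ≡ b
¬′-injective refl = refl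

□-injective : ∀ {a b} → □ a ≡ □ b → a ≡ b
□-injective refl = refl

_≟ᶠ_ : DecidableEquality Fm
var m   ≟ᶠ var n   = map′ (cong var) var-injective (m ≟ℕ n)
(a ∨ b) ≟ᶠ (c ∨ d) = map′ (uncurry (cong₂ _∨_)) ∨-injective (a ≟ᶠ c ×-dec b ≟ᶠ d)
(a ∧ b) ≟ᶠ (c ∧ d) = map′ (uncurry (cong₂ _∧_)) ∧-injective (a ≟ᶠ c ×-dec b ≟ᶠ d)
¬′ a    ≟ᶠ ¬′ b    = map′ (cong ¬′) ¬′-injective (a ≟ᶠ b)
□ a     ≟ᶠ □ b     = map′ (cong □) □-injective (a ≟ᶠ b)
var _   ≟ᶠ (_ ∨ _) = no λ ()
var _   ≟ᶠ (_ ∧ _) = no λ ()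
var _   ≟ᶠ ¬′ _    = no λ ()
var _   ≟ᶠ □ _     = no λ ()
(_ ∨ _) ≟ᶠ var _   = no λ ()
(_ ∨ _) ≟ᶠ (_ ∧ _) = no λ ()
(_ ∨ _) ≟ᶠ ¬′ _    = no λ ()
(_ ∨ _) ≟ᶠ □ _     = no λ ()
(_ ∧ _) ≟ᶠ var _   = no λ ()
(_ ∧ _) ≟ᶠ (_ ∨ _) = no λ ()
(_ ∧ _) ≟ᶠ ¬′ _    = no λ ()
(_ ∧ _) ≟ᶠ □ _     = no λ ()
¬′ _    ≟ᶠ var _   = no λ ()
¬′ _    ≟ᶠ (_ ∨ _) = no λ ()
¬′ _    ≟ᶠ (_ ∧ _) = no λ ()
¬′ _    ≟ᶠ □ _     = no λ ()
□ _     ≟ᶠ var _   = no λ ()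
□ _     ≟ᶠ (_ ∨ _) = no λ ()
□ _     ≟ᶠ (_ ∧ _) = no λ ()
□ _     ≟ᶠ ¬′ _    = no λ ()

T-injective : ∀ {a b} → T a ≡ T b → a ≡ b
T-injective refl = refl

F-injective : ∀ {a b} → F a ≡ F b → a ≡ b
F-injective refl = refl

_≟ˢ_ : DecidableEquality Signed
T a ≟ˢ T b = map′ (cong T) T-injective (a ≟ᶠ b)
F a ≟ˢ F b = map′ (cong F) F-injective (a ≟ᶠ b)
T _ ≟ˢ F _ = no λ ()
F _ ≟ˢ T _ = no λ ()

open DecMembership _≟ˢ_ using (_∈?_)

ContradictedIn : List Signed → Signed → Set
ContradictedIn φs (T γ) = F γ ∈ φs
ContradictedIn φs (F γ) = ⊥

contradictedIn? : ∀ φs φ → Dec (ContradictedIn φs φ)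
contradictedIn? φs (T γ) = F γ ∈? φs
contradictedIn? φs (F γ) = no λ ()

closed? : ∀ b → Dec (Closed b)
closed? b =
  map′ witness (λ (_ , Tγ∈b , Fγ∈b) → lose Tγ∈b Fγ∈b)
       (any? (contradictedIn? (formulas b)) (formulas b))
  where
  witness : Any (ContradictedIn (formulas b)) (formulas b) → Closed b
  witness contradiction with find contradiction
  ... | T γ , Tγ∈b , Fγ∈b = γ , Tγ∈b , Fγ∈b

open? : ∀ bs → Dec (OpenTableau bs)
open? bs = map′ find (λ (b , b∈bs , ¬closed) → lose b∈bs ¬closed) (any? (¬? ∘ closed?) bs)

proposition6p3 : (α : Fm) → ¬ ⊨TML α →
                 (bs : List Branch) → IsTableau (F α) bs → Completed bs →
                 OpenTableau bs
proposition6p3 α ⊭α bs t _ =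
  decidable-stable (open? bs) (λ ¬open → ⊭α (closed-tableau⇒valid t ¬open))
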